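{- For all positive integers $n,t$ and $q\ge 2$, the Hamming graph $H(n+t,q)$ covers the multigraph $H(n,q)+t(q-1)I$.
   Context: The Hamming graph $H(n,q)$ has vertex set $\mathbb{Z}_q^n$; two vertices are adjacent iff they differ in exactly one coordinate. For a multigraph $G$ and integer $s\ge 1$, $G+sI$ is the multigraph obtained from $G$ by adding $s$ loops at every vertex; each loop at $v$ contributes $v$ once to the multiset of neighbors of $v$ (and $1$ to its degree). A multigraph $G=(V,E)$ covers a multigraph $H=(U,W)$ if there is a surjective map $\varphi:V\to U$ such that for every $v\in V$ the multiset of $\varphi(u)$ over the neighbors $u$ of $v$ (with multiplicity) equals the multiset of neighbors of $\varphi(v)$ in $H$ (with multiplicity). -}

module Defs where

open import Data.Nat using (ℕ)
open import Data.Fin using (Fin)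
open import Data.Fin.Properties using (_≟_)
open import Data.Vec using (Vec; lookup; _[_]≔_; allFin)
  renaming (toList to vtoList)
open import Data.List using (List; map; concatMap; filter; _++_; replicate)
open import Data.List.Relation.Binary.Permutation.Propositional using (_↭_)
open import Data.Product using (Σ; ∃; _×_)
open import Relation.Nullary.Decidable using (¬?)
open import Relation.Binary.PropositionalEquality using (_≡_)

-- A (finite) multigraph, given by the multiset (list up to permutation)
-- of neighbours of every vertex; a loop at v contributes v once.
record Multigraph : Set₁ where
  field
    V    : Set
    nbrs : V → List V
open Multigraph public

allFinL : (q : ℕ) → List (Fin q)
allFinL q = vtoList (allFin q)

Hamming : (n q : ℕ) → Multigraph
Hamming n q = record
  { V    = Vec (Fin q) n
  ; nbrs = λ v → concatMap
      (λ i → map (λ a → v [ i ]≔ a)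
                 (filter (λ a → ¬? (a ≟ lookup v i)) (allFinL q)))
      (allFinL n)
  }

addLoops : Multigraph → ℕ → Multigraph
addLoops G s = record
  { V    = V G
  ; nbrs = λ v → nbrs G v ++ replicate s v
  }

Covers : Multigraph → Multigraph → Set
Covers G H =
  Σ (V G → V H) λ φ →
    ((y : V H) → ∃ λ x → φ x ≡ y)
    × ((v : V G) → map φ (nbrs G v) ↭ nbrs H (φ v))

module Submission where

-- The covering map is the projection  φ = take n : ℤ_q^(n+t) → ℤ_q^n  onto the
-- first n coordinates.  It is surjective (pad a word with t zeros).  For the
-- neighbourhood condition write a vertex as  w ++ u  with  w ∈ ℤ_q^n, u ∈ ℤ_q^t.
-- Its neighbours are grouped by the coordinate that is changed:
--   * changing one of the first n coordinates of w ++ u and projecting is the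
--     same as changing that coordinate of w, so these neighbours project onto
--     exactly the neighbours of w in H(n,q);
--   * changing one of the last t coordinates leaves the projection equal to w,
--     and each such coordinate can be changed in exactly q − 1 ways, so these
--     neighbours project onto t·(q − 1) copies of w, i.e. the added loops.

open import Defs
open import Data.Nat using (ℕ; zero; suc; _+_; _*_; _∸_; _≤_)
open import Data.Fin using (Fin; _↑ˡ_; _↑ʳ_) renaming (zero to fzero; suc to fsuc)
open import Data.Fin.Properties using (_≟_)
open import Data.Vec using (Vec; []; _∷_; lookup; _[_]≔_; allFin; tabulate; take; drop; _++_)
  renaming (toList to vtoList; replicate to vreplicate; map to vmap)
open import Data.Vec.Properties using (tabulate-allFin; toList-map; take++drop≡id; length-toList; lookup-++ˡ; []≔-++-↑ˡ; []≔-++-↑ʳ)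
open import Data.List using (List; map; concatMap; filter; replicate; length)
  renaming (_++_ to _++ₗ_; [] to []ₗ; _∷_ to _∷ₗ_)
open import Data.List.Properties using (map-∘; map-cong; concatMap-cong; map-concatMap; concatMap-map; ++-assoc)
open import Data.List.Relation.Binary.Permutation.Propositional using (↭-reflexive)
open import Data.Product using (_,_)
open import Relation.Nullary.Decidable using (¬?; yes; no)
open import Relation.Binary.PropositionalEquality using (_≡_; refl; sym; cong; cong₂; module ≡-Reasoning)
open import Function using (_∘_)

open ≡-Reasoning

take-++ : {A : Set} {n t : ℕ} (w : Vec A n) (u : Vec A t) → take n (w ++ u) ≡ w
take-++ []      u = refl
take-++ (a ∷ w) u = cong (a ∷_) (take-++ w u)

map-const : {A B : Set} (w : A) (xs : List B) → map (λ _ → w) xs ≡ replicate (length xs) w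
map-const w []ₗ       = refl
map-const w (x ∷ₗ xs) = cong (w ∷ₗ_) (map-const w xs)

replicate-+ : {A : Set} (a b : ℕ) (w : A) → replicate a w ++ₗ replicate b w ≡ replicate (a + b) w
replicate-+ zero    b w = refl
replicate-+ (suc a) b w = cong (w ∷ₗ_) (replicate-+ a b w)

concatMap-replicate : {A B : Set} (r : ℕ) (w : A) (ys : List B) →
  concatMap (λ _ → replicate r w) ys ≡ replicate (length ys * r) w
concatMap-replicate r w []ₗ       = refl
concatMap-replicate r w (y ∷ₗ ys) = begin
  replicate r w ++ₗ concatMap (λ _ → replicate r w) ys ≡⟨ cong (replicate r w ++ₗ_) (concatMap-replicate r w ys) ⟩
  replicate r w ++ₗ replicate (length ys * r) w        ≡⟨ replicate-+ r (length ys * r) w ⟩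
  replicate (r + length ys * r) w                     ∎

toList-tabulate : {A : Set} {k : ℕ} (f : Fin k → A) → vtoList (tabulate f) ≡ map f (allFinL k)
toList-tabulate {k = k} f = begin
  vtoList (tabulate f)        ≡⟨ cong vtoList (tabulate-allFin f) ⟩
  vtoList (vmap f (allFin k)) ≡⟨ toList-map f (allFin k) ⟩
  map f (allFinL k)           ∎

allFinL-suc : (k : ℕ) → allFinL (suc k) ≡ fzero ∷ₗ map fsuc (allFinL k)
allFinL-suc k = cong (fzero ∷ₗ_) (toList-tabulate fsuc)

concatMap-tabulate : {A B : Set} {k : ℕ} (h : A → List B) (f : Fin k → A) →
  concatMap h (vtoList (tabulate f)) ≡ concatMap (h ∘ f) (allFinL k)
concatMap-tabulate h f = begin
  concatMap h (vtoList (tabulate f)) ≡⟨ cong (concatMap h) (toList-tabulate f) ⟩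
  concatMap h (map f (allFinL _))    ≡⟨ concatMap-map h f (allFinL _) ⟩
  concatMap (h ∘ f) (allFinL _)      ∎

concatMap-allFin-+ : {B : Set} (n t : ℕ) (h : Fin (n + t) → List B) →
  concatMap h (allFinL (n + t))
    ≡ concatMap (h ∘ (_↑ˡ t)) (allFinL n) ++ₗ concatMap (h ∘ (n ↑ʳ_)) (allFinL t)
concatMap-allFin-+ zero    t h = refl
concatMap-allFin-+ {B} (suc n) t h = begin
  h fzero ++ₗ concatMap h (vtoList (tabulate fsuc))
    ≡⟨ cong (h fzero ++ₗ_) (concatMap-tabulate h fsuc) ⟩
  h fzero ++ₗ concatMap (h ∘ fsuc) (allFinL (n + t))
    ≡⟨ cong (h fzero ++ₗ_) (concatMap-allFin-+ n t (h ∘ fsuc)) ⟩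
  h fzero ++ₗ (concatMap (h ∘ fsuc ∘ (_↑ˡ t)) (allFinL n) ++ₗ right)
    ≡⟨ sym (++-assoc (h fzero) _ right) ⟩
  (h fzero ++ₗ concatMap (h ∘ fsuc ∘ (_↑ˡ t)) (allFinL n)) ++ₗ right
    ≡⟨ cong (λ xs → (h fzero ++ₗ xs) ++ₗ right) (sym (concatMap-tabulate (h ∘ (_↑ˡ t)) fsuc)) ⟩
  (h fzero ++ₗ concatMap (h ∘ (_↑ˡ t)) (vtoList (tabulate fsuc))) ++ₗ right
    ∎
  where
  right : List B
  right = concatMap (h ∘ (suc n ↑ʳ_)) (allFinL t)

others : {q : ℕ} → Fin q → List (Fin q) → List (Fin q)
others c = filter (λ a → ¬? (a ≟ c))

others-suc : {m : ℕ} (c : Fin m) (xs : List (Fin m)) →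
  length (others (fsuc c) (map fsuc xs)) ≡ length (others c xs)
others-suc c []ₗ = refl
others-suc c (a ∷ₗ xs) with a ≟ c
... | yes _ = others-suc c xs
... | no  _ = cong suc (others-suc c xs)

others-zero : {m : ℕ} (xs : List (Fin m)) → length (others fzero (map fsuc xs)) ≡ length xs
others-zero []ₗ       = refl
others-zero (a ∷ₗ xs) = cong suc (others-zero xs)

count-others : (m : ℕ) (c : Fin (suc m)) → length (others c (allFinL (suc m))) ≡ m
count-others m fzero = begin
  length (others fzero (allFinL (suc m)))        ≡⟨ cong (length ∘ others fzero) (allFinL-suc m) ⟩
  length (others fzero (map fsuc (allFinL m)))   ≡⟨ others-zero (allFinL m) ⟩
  length (allFinL m)                             ≡⟨ length-toList (allFin m) ⟩
  m                                              ∎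
count-others (suc m) (fsuc c) = begin
  length (others (fsuc c) (allFinL (suc (suc m))))
    ≡⟨ cong (length ∘ others (fsuc c)) (allFinL-suc (suc m)) ⟩
  suc (length (others (fsuc c) (map fsuc (allFinL (suc m)))))
    ≡⟨ cong suc (others-suc c (allFinL (suc m))) ⟩
  suc (length (others c (allFinL (suc m))))
    ≡⟨ cong suc (count-others m c) ⟩
  suc m
    ∎

changes : {n q : ℕ} → Vec (Fin q) n → Fin n → List (Vec (Fin q) n)
changes {q = q} v i = map (v [ i ]≔_) (others (lookup v i) (allFinL q))

changes-↑ˡ : {n t q : ℕ} (w : Vec (Fin q) n) (u : Vec (Fin q) t) (i : Fin n) →
  map (take n) (changes (w ++ u) (i ↑ˡ t)) ≡ changes w i
changes-↑ˡ {n} {t} {q} w u i = begin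
  map (take n) (map ((w ++ u) [ i ↑ˡ t ]≔_) (others (lookup (w ++ u) (i ↑ˡ t)) (allFinL q)))
    ≡⟨ cong (λ c → map (take n) (map ((w ++ u) [ i ↑ˡ t ]≔_) (others c (allFinL q)))) (lookup-++ˡ w u i) ⟩
  map (take n) (map ((w ++ u) [ i ↑ˡ t ]≔_) (others (lookup w i) (allFinL q)))
    ≡⟨ sym (map-∘ (others (lookup w i) (allFinL q))) ⟩
  map (take n ∘ ((w ++ u) [ i ↑ˡ t ]≔_)) (others (lookup w i) (allFinL q))
    ≡⟨ map-cong project-update (others (lookup w i) (allFinL q)) ⟩
  changes w i
    ∎
  where
  project-update : (a : Fin q) → take n ((w ++ u) [ i ↑ˡ t ]≔ a) ≡ w [ i ]≔ a
  project-update a = begin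
    take n ((w ++ u) [ i ↑ˡ t ]≔ a) ≡⟨ cong (take n) ([]≔-++-↑ˡ w u i) ⟩
    take n ((w [ i ]≔ a) ++ u)      ≡⟨ take-++ (w [ i ]≔ a) u ⟩
    w [ i ]≔ a                      ∎

changes-↑ʳ : {n t m : ℕ} (w : Vec (Fin (suc m)) n) (u : Vec (Fin (suc m)) t) (k : Fin t) →
  map (take n) (changes (w ++ u) (n ↑ʳ k)) ≡ replicate m w
changes-↑ʳ {n} {t} {m} w u k = begin
  map (take n) (map ((w ++ u) [ n ↑ʳ k ]≔_) values)
    ≡⟨ sym (map-∘ values) ⟩
  map (take n ∘ ((w ++ u) [ n ↑ʳ k ]≔_)) values
    ≡⟨ map-cong project-update values ⟩
  map (λ _ → w) values
    ≡⟨ map-const w values ⟩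
  replicate (length values) w
    ≡⟨ cong (λ r → replicate r w) (count-others m (lookup (w ++ u) (n ↑ʳ k))) ⟩
  replicate m w
    ∎
  where
  values : List (Fin (suc m))
  values = others (lookup (w ++ u) (n ↑ʳ k)) (allFinL (suc m))
  project-update : (a : Fin (suc m)) → take n ((w ++ u) [ n ↑ʳ k ]≔ a) ≡ w
  project-update a = begin
    take n ((w ++ u) [ n ↑ʳ k ]≔ a) ≡⟨ cong (take n) ([]≔-++-↑ʳ w u k) ⟩
    take n (w ++ (u [ k ]≔ a))      ≡⟨ take-++ w (u [ k ]≔ a) ⟩
    w                               ∎

project-nbrs : (n t m : ℕ) (w : Vec (Fin (suc m)) n) (u : Vec (Fin (suc m)) t) →
  map (take n) (nbrs (Hamming (n + t) (suc m)) (w ++ u))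
    ≡ nbrs (addLoops (Hamming n (suc m)) (t * m)) w
project-nbrs n t m w u = begin
  map (take n) (concatMap (changes (w ++ u)) (allFinL (n + t)))
    ≡⟨ map-concatMap (take n) (changes (w ++ u)) (allFinL (n + t)) ⟩
  concatMap (map (take n) ∘ changes (w ++ u)) (allFinL (n + t))
    ≡⟨ concatMap-allFin-+ n t (map (take n) ∘ changes (w ++ u)) ⟩
  concatMap (map (take n) ∘ changes (w ++ u) ∘ (_↑ˡ t)) (allFinL n)
    ++ₗ concatMap (map (take n) ∘ changes (w ++ u) ∘ (n ↑ʳ_)) (allFinL t)
    ≡⟨ cong₂ _++ₗ_ (concatMap-cong (changes-↑ˡ w u) (allFinL n))
                   (concatMap-cong (changes-↑ʳ w u) (allFinL t)) ⟩
  concatMap (changes w) (allFinL n) ++ₗ concatMap (λ _ → replicate m w) (allFinL t)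
    ≡⟨ cong (concatMap (changes w) (allFinL n) ++ₗ_) (concatMap-replicate m w (allFinL t)) ⟩
  concatMap (changes w) (allFinL n) ++ₗ replicate (length (allFinL t) * m) w
    ≡⟨ cong (λ s → concatMap (changes w) (allFinL n) ++ₗ replicate (s * m) w) (length-toList (allFin t)) ⟩
  concatMap (changes w) (allFinL n) ++ₗ replicate (t * m) w
    ∎

project-nbrs-take : (n t m : ℕ) (v : Vec (Fin (suc m)) (n + t)) →
  map (take n) (nbrs (Hamming (n + t) (suc m)) v)
    ≡ nbrs (addLoops (Hamming n (suc m)) (t * m)) (take n v)
project-nbrs-take n t m v = begin
  map (take n) (nbrs (Hamming (n + t) (suc m)) v)
    ≡⟨ cong (map (take n) ∘ nbrs (Hamming (n + t) (suc m))) (sym (take++drop≡id n v)) ⟩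
  map (take n) (nbrs (Hamming (n + t) (suc m)) (take n v ++ drop n v))
    ≡⟨ project-nbrs n t m (take n v) (drop n v) ⟩
  nbrs (addLoops (Hamming n (suc m)) (t * m)) (take n v)
    ∎

hamming-covers : (n t m : ℕ) →
  Covers (Hamming (n + t) (suc m)) (addLoops (Hamming n (suc m)) (t * m))
hamming-covers n t m =
    take n
  , (λ w → w ++ vreplicate t fzero , take-++ w (vreplicate t fzero))
  , (λ v → ↭-reflexive (project-nbrs-take n t m v))

-- The theorem; only q ≥ 1 is needed.
proposition5 : (n t q : ℕ) → 1 ≤ n → 1 ≤ t → 2 ≤ q →
    Covers (Hamming (n + t) q) (addLoops (Hamming n q) (t * (q ∸ 1)))
proposition5 n t zero    _ _ ()
proposition5 n t (suc m) _ _ _  = hamming-covers n t m
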